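{- If $k\ge 2$ is an integer and $G$ is a finite simple graph of order $n\ge 2k-2$, then $d_R^k(G)\ge 2k-1$.
   Context: A Roman $k$-dominating function (RkDF) on a graph $G$ is a map $f:V(G)\to\{0,1,2\}$ such that every vertex $v$ with $f(v)=0$ has at least $k$ neighbors $u$ with $f(u)=2$. A set $\{f_1,\ldots,f_d\}$ of pairwise distinct RkDFs on $G$ with $\sum_{i=1}^d f_i(v)\le 2k$ for every $v\in V(G)$ is a Roman $(k,k)$-dominating family on $G$; the maximum number of functions in such a family is the Roman $(k,k)$-domatic number $d_R^k(G)$. -}

module Defs where

open import Data.Nat using (ℕ; _+_; _*_; _≤_; _≡ᵇ_)
open import Data.Bool using (Bool; true; false; _∧_; if_then_else_)
open import Data.Fin using (Fin)
open import Data.List using (map; allFin)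
open import Data.Nat.ListAction using (sum)
open import Data.Product using (Σ; _×_)
open import Relation.Binary.PropositionalEquality using (_≡_)
open import Relation.Nullary using (¬_)

record Graph (n : ℕ) : Set where
  field
    adj   : Fin n → Fin n → Bool
    sym   : ∀ u v → adj u v ≡ adj v u
    irrefl : ∀ v → adj v v ≡ false
open Graph public

-- A labelling V(G) → {0,1,2}, given as ℕ-valued with values ≤ 2
Labelling : ℕ → Set
Labelling n = Fin n → ℕ

twoNeighbours : {n : ℕ} → Graph n → Labelling n → Fin n → ℕ
twoNeighbours {n} G f v =
  sum (map (λ u → if adj G v u ∧ (f u ≡ᵇ 2) then 1 else 0) (allFin n))

IsRkDF : {n : ℕ} → ℕ → Graph n → Labelling n → Set
IsRkDF {n} k G f =
  (∀ v → f v ≤ 2) × (∀ v → f v ≡ 0 → k ≤ twoNeighbours G f v)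

sumFam : {n : ℕ} (d : ℕ) → (Fin d → Labelling n) → Fin n → ℕ
sumFam {n} d F v = sum (map (λ i → F i v) (allFin d))

IsRkkFamily : {n : ℕ} → ℕ → Graph n → (d : ℕ) → (Fin d → Labelling n) → Set
IsRkkFamily {n} k G d F =
  (∀ i → IsRkDF k G (F i))
  × (∀ i j → ¬ (i ≡ j) → ¬ (∀ v → F i v ≡ F j v))
  × (∀ v → sumFam d F v ≤ 2 * k)

-- d_R^k(G) ≥ m  (d_R^k is the maximum size of such a family, so this
-- holds iff some Roman (k,k)-dominating family has at least m functions)
dRk≥ : {n : ℕ} → ℕ → Graph n → ℕ → Set
dRk≥ {n} k G m = Σ ℕ λ d → (m ≤ d) × Σ (Fin d → Labelling n) (IsRkkFamily k G d)

module Submission where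

-- A
-- labelling that never takes the value 0 is trivially Roman
-- k-dominating, so we use the labellings  raisedAt c  which equal 2 at
-- the vertex with index c-1 and 1 everywhere else (raisedAt 0 is
-- constantly 1).  The family is  i ↦ raisedAt i  for i < d = 2k-1.
--   * Each member takes values in {1,2}, hence is an RkDF.
--   * Distinctness: raisedAt c has its unique 2 at vertex c-1, which
--     exists because c ≤ d-1 = 2k-2 ≤ n; so raisedAt is injective there.
--   * Sum bound: at a vertex v the sum is d plus the number of i < d with
--     i = v+1, which is at most one; so it is at most d+1 = 2k.

open import Defs hiding (sym)
open import Data.Nat using (ℕ; zero; suc; _≤_; _<_; _+_; _*_; _∸_; _≡ᵇ_; s≤s; z≤n)
open import Data.Nat.Properties
  using ( ≤-refl; ≤-reflexive; ≤-trans; ≤-pred; +-monoʳ-≤; +-comm; +-assoc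
        ; m≤m+n; suc-injective; ≡ᵇ⇒≡; ≡⇒≡ᵇ; module ≤-Reasoning )
open import Data.Nat.ListAction using (sum)
open import Data.Bool using (true; false; if_then_else_; T)
open import Data.Fin using (Fin; toℕ; fromℕ<) renaming (zero to fzero; suc to fsuc)
open import Data.Fin.Properties using (toℕ<n; toℕ-fromℕ<; toℕ-injective)
open import Data.List using (tabulate)
open import Data.List.Properties using (map-tabulate)
open import Data.Product using (_,_)
open import Data.Empty using (⊥-elim)
open import Relation.Binary.PropositionalEquality
open import Relation.Nullary using (¬_)

nonzero-isRkDF : ∀ {n} k (G : Graph n) (f : Labelling n) →
  (∀ v → 1 ≤ f v) → (∀ v → f v ≤ 2) → IsRkDF k G f
nonzero-isRkDF k G f positive bounded = bounded , zero-case
  where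
  zero-case : ∀ v → f v ≡ 0 → k ≤ twoNeighbours G f v
  zero-case v fv≡0 with () ← subst (1 ≤_) fv≡0 (positive v)

indicator : ℕ → ℕ → ℕ
indicator a c = if a ≡ᵇ c then 1 else 0

indicator-≤1 : ∀ a c → indicator a c ≤ 1
indicator-≤1 a c with a ≡ᵇ c
... | true  = ≤-refl
... | false = z≤n

indicator-refl : ∀ a → indicator a a ≡ 1
indicator-refl a with a ≡ᵇ a in eq
... | true  = refl
... | false = ⊥-elim (subst T eq (≡⇒≡ᵇ a a refl))

indicator-sound : ∀ a c → indicator a c ≡ 1 → a ≡ c
indicator-sound a c hit with a ≡ᵇ c in eq
... | true  = ≡ᵇ⇒≡ a c (subst T (sym eq) _)
... | false with () ← hit

raisedAt : ∀ {n} → ℕ → Labelling n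
raisedAt c v = suc (indicator c (suc (toℕ v)))

raisedAt-isRkDF : ∀ {n} k (G : Graph n) c → IsRkDF k G (raisedAt c)
raisedAt-isRkDF k G c =
  nonzero-isRkDF k G (raisedAt c) (λ _ → s≤s z≤n)
                 (λ v → s≤s (indicator-≤1 c (suc (toℕ v))))

raisedAt-peak : ∀ {n} c (v : Fin n) → raisedAt c v ≡ 2 → c ≡ suc (toℕ v)
raisedAt-peak c v two = indicator-sound c (suc (toℕ v)) (suc-injective two)

raisedAt-hits : ∀ {n} (v : Fin n) → raisedAt (suc (toℕ v)) v ≡ 2
raisedAt-hits v = cong suc (indicator-refl (suc (toℕ v)))

raisedAt-determines : ∀ {n} a c′ → a < n →
  (∀ (v : Fin n) → raisedAt (suc a) v ≡ raisedAt c′ v) → suc a ≡ c′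
raisedAt-determines a c′ a<n same = begin
  suc a                 ≡⟨ cong suc (sym (toℕ-fromℕ< a<n)) ⟩
  suc (toℕ w)           ≡⟨ sym (raisedAt-peak c′ w c′-hits) ⟩
  c′                    ∎
  where
  open ≡-Reasoning
  w : Fin _
  w = fromℕ< a<n
  c′-hits : raisedAt c′ w ≡ 2
  c′-hits = trans (sym (same w))
                  (subst (λ x → raisedAt (suc x) w ≡ 2) (toℕ-fromℕ< a<n) (raisedAt-hits w))

raisedAt-injective : ∀ {n} c c′ → c ≤ n → c′ ≤ n →
  (∀ (v : Fin n) → raisedAt c v ≡ raisedAt c′ v) → c ≡ c′
raisedAt-injective zero    zero     _   _    _    = refl
raisedAt-injective (suc a) c′       c≤n _    same = raisedAt-determines a c′ c≤n same
raisedAt-injective zero    (suc b)  _   c′≤n same =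
  sym (raisedAt-determines b zero c′≤n (λ v → sym (same v)))

indicator-count : ∀ d c → sum (tabulate {n = d} (λ i → indicator (toℕ i) c)) ≤ 1
indicator-count zero    c       = z≤n
indicator-count (suc d) zero    = s≤s (≤-reflexive (sum-zeros d))
  where
  sum-zeros : ∀ m → sum (tabulate {n = m} (λ _ → 0)) ≡ 0
  sum-zeros zero    = refl
  sum-zeros (suc m) = sum-zeros m
indicator-count (suc d) (suc c) = indicator-count d c

sum-tabulate-suc : ∀ d (g : Fin d → ℕ) →
  sum (tabulate (λ i → suc (g i))) ≡ d + sum (tabulate g)
sum-tabulate-suc zero    g = refl
sum-tabulate-suc (suc d) g = cong suc (begin
  g₀ + sum (tabulate (λ i → suc (g (fsuc i))))  ≡⟨ cong (g₀ +_) (sum-tabulate-suc d (λ i → g (fsuc i))) ⟩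
  g₀ + (d + rest)                               ≡⟨ sym (+-assoc g₀ d rest) ⟩
  (g₀ + d) + rest                               ≡⟨ cong (_+ rest) (+-comm g₀ d) ⟩
  (d + g₀) + rest                               ≡⟨ +-assoc d g₀ rest ⟩
  d + (g₀ + rest)                               ∎)
  where
  open ≡-Reasoning
  g₀ rest : ℕ
  g₀ = g fzero
  rest = sum (tabulate (λ i → g (fsuc i)))

raisedFamily : (d n : ℕ) → Fin d → Labelling n
raisedFamily d n i = raisedAt (toℕ i)

raisedFamily-sum : ∀ d n (v : Fin n) → sumFam d (raisedFamily d n) v ≤ suc d
raisedFamily-sum d n v = begin
  sumFam d (raisedFamily d n) v
    ≡⟨ cong sum (map-tabulate {n = d} (λ i → i) (λ i → raisedAt {n} (toℕ i) v)) ⟩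
  sum (tabulate {n = d} (λ i → raisedAt {n} (toℕ i) v))
    ≡⟨ sum-tabulate-suc d (λ i → indicator (toℕ i) (suc (toℕ v))) ⟩
  d + sum (tabulate {n = d} (λ i → indicator (toℕ i) (suc (toℕ v))))
    ≤⟨ +-monoʳ-≤ d (indicator-count d (suc (toℕ v))) ⟩
  d + 1
    ≡⟨ +-comm d 1 ⟩
  suc d ∎
  where open ≤-Reasoning

raisedFamily-isRkkFamily : ∀ k {n} (G : Graph n) d → d ≤ suc n → suc d ≤ 2 * k →
  IsRkkFamily k G d (raisedFamily d n)
raisedFamily-isRkkFamily k {n} G d d≤n+1 d+1≤2k =
  (λ i → raisedAt-isRkDF k G (toℕ i)) , distinct , sums
  where
  index≤n : ∀ (i : Fin d) → toℕ i ≤ n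
  index≤n i = ≤-pred (≤-trans (toℕ<n i) d≤n+1)
  distinct : ∀ i j → ¬ i ≡ j → ¬ (∀ v → raisedFamily d n i v ≡ raisedFamily d n j v)
  distinct i j i≢j same =
    i≢j (toℕ-injective (raisedAt-injective (toℕ i) (toℕ j) (index≤n i) (index≤n j) same))
  sums : ∀ v → sumFam d (raisedFamily d n) v ≤ 2 * k
  sums v = ≤-trans (raisedFamily-sum d n v) d+1≤2k

pred≤suc-pred-pred : ∀ m → m ∸ 1 ≤ suc (m ∸ 2)
pred≤suc-pred-pred zero          = z≤n
pred≤suc-pred-pred (suc zero)    = z≤n
pred≤suc-pred-pred (suc (suc m)) = ≤-refl

suc-pred≤ : ∀ m → 1 ≤ m → suc (m ∸ 1) ≤ m
suc-pred≤ (suc m) _ = ≤-refl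

mainTheorem17 : (k n : ℕ) → 2 ≤ k → 2 * k ∸ 2 ≤ n → (G : Graph n) →
    dRk≥ k G (2 * k ∸ 1)
mainTheorem17 k n 2≤k 2k-2≤n G =
  d , ≤-refl , raisedFamily d n , raisedFamily-isRkkFamily k G d d≤n+1 d+1≤2k
  where
  d : ℕ
  d = 2 * k ∸ 1
  d≤n+1 : d ≤ suc n
  d≤n+1 = ≤-trans (pred≤suc-pred-pred (2 * k)) (s≤s 2k-2≤n)
  1≤2k : 1 ≤ 2 * k
  1≤2k = ≤-trans (s≤s z≤n) (≤-trans 2≤k (m≤m+n k (k + 0)))
  d+1≤2k : suc d ≤ 2 * k
  d+1≤2k = suc-pred≤ (2 * k) 1≤2k
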